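{- Let $G$ and $H$ be graphs with $\delta(H)\ge 2$, and let $\vec H$ be an anti-directed orientation of $H$. If $m(G)<\delta(H)-1/2$, then $G\not\to\vec H$, i.e., $G$ has an orientation containing no copy of $\vec H$.
   Context: An oriented graph is anti-directed if each vertex has either no in-neighbours or no out-neighbours. $m(G)=\max\{e(J)/v(J):J\subseteq G,\ v(J)\ge1\}$. $\delta(H)$ is the minimum degree of $H$. -}

module Defs where

open import Data.Nat using (ℕ; zero; suc; _+_; _*_; _∸_; _≤_; _<_; _<ᵇ_)
open import Data.Bool using (Bool; true; false; _∧_; if_then_else_)
open import Data.Fin using (Fin; toℕ)
open import Data.Product using (Σ; _×_; ∃)
open import Data.Sum using (_⊎_)
open import Relation.Binary.PropositionalEquality using (_≡_)
open import Relation.Nullary using (¬_)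
open import Function.Definitions using (Injective)

count : ∀ {n} → (Fin n → Bool) → ℕ
count {zero}  p = 0
count {suc n} p = (if p Fin.zero then 1 else 0) + count (λ i → p (Fin.suc i))

sumFin : ∀ {n} → (Fin n → ℕ) → ℕ
sumFin {zero}  f = 0
sumFin {suc n} f = f Fin.zero + sumFin (λ i → f (Fin.suc i))

record Graph (n : ℕ) : Set where
  field
    adj    : Fin n → Fin n → Bool
    sym    : ∀ u v → adj u v ≡ adj v u
    irrefl : ∀ v → adj v v ≡ false
open Graph public

vcount : ∀ {n} → Graph n → ℕ
vcount {n} _ = n

ecount : ∀ {n} → Graph n → ℕ
ecount G = sumFin (λ u → count (λ v → adj G u v ∧ (toℕ u <ᵇ toℕ v)))

degree : ∀ {n} → Graph n → Fin n → ℕ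
degree G v = count (λ u → adj G v u)

IsMinDegree : ∀ {n} → Graph n → ℕ → Set
IsMinDegree H d = (∀ v → d ≤ degree H v) × (∃ λ v → degree H v ≡ d)

Subgraph : ∀ {k n} → Graph k → Graph n → Set
Subgraph {k} {n} J G =
  Σ (Fin k → Fin n) λ f → Injective _≡_ _≡_ f ×
    (∀ u v → adj J u v ≡ true → adj G (f u) (f v) ≡ true)

record Orientation {n : ℕ} (G : Graph n) : Set where
  field
    arc      : Fin n → Fin n → Bool
    arc⇒adj  : ∀ u v → arc u v ≡ true → adj G u v ≡ true
    adj⇒arc  : ∀ u v → adj G u v ≡ true → (arc u v ≡ true) ⊎ (arc v u ≡ true)
    antisym  : ∀ u v → arc u v ≡ true → arc v u ≡ false
open Orientation public

AntiDirected : ∀ {n} {H : Graph n} → Orientation H → Set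
AntiDirected {n} O = ∀ v → (∀ u → arc O u v ≡ false) ⊎ (∀ u → arc O v u ≡ false)

ContainsCopy : ∀ {n h} {G : Graph n} {H : Graph h} → Orientation G → Orientation H → Set
ContainsCopy {n} {h} O P =
  Σ (Fin h → Fin n) λ f → Injective _≡_ _≡_ f ×
    (∀ u v → arc P u v ≡ true → arc O (f u) (f v) ≡ true)

-- m(G) < d - 1/2, i.e. e(J)/v(J) < d - 1/2 for every subgraph J with v(J) ≥ 1,
-- written with denominators cleared: 2 e(J) < (2d - 1) v(J)
MaxDensityBelowHalf : ∀ {n} → Graph n → ℕ → Set
MaxDensityBelowHalf G d =
  ∀ {k} (J : Graph k) → Subgraph J G → 1 ≤ vcount J →
    2 * ecount J < (2 * d ∸ 1) * vcount J

-- Counting degrees, 2 e(G) < (2d - 1) v(G) gives a vertex w of degree at most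
-- 2d - 2. Orient G - w recursively, then direct d - 1 of the edges at w out of w and the
-- remaining at most d - 1 into w. A copy of the anti-directed graph P avoiding w is a copy in
-- G - w; a copy through w maps a source or sink x of P to w, but x has degree at least d while
-- w has in- and out-degree at most d - 1.
module Submission where

open import Defs
open import Data.Nat using (ℕ; _≤_)
open import Data.Product using (Σ)
open import Relation.Nullary using (¬_)

open import Data.Nat using (zero; suc; _+_; _*_; _∸_; _<_; z≤n; s≤s; s≤s⁻¹; _<ᵇ_; _<?_)
open import Data.Nat.Properties
  using (≤-refl; ≤-reflexive; ≤-trans; ≤⇒≯; ≮⇒≥; +-mono-≤;
         +-identityʳ; *-suc; *-zeroʳ; m<n+o⇒m∸n<o; module ≤-Reasoning)
open import Data.Nat.Solver using (module +-*-Solver)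
open import Data.Bool using (Bool; true; false; _∧_; not; if_then_else_)
open import Data.Bool.Properties using (∧-zeroʳ; ∧-identityʳ)
open import Data.Fin using (Fin; toℕ; punchIn; punchOut; _≟_)
open import Data.Fin.Properties
  using (any?; punchIn-punchOut; punchIn-injective; punchOut-injective; punchOut-cong)
  renaming (suc-injective to Fin-suc-injective)
open import Data.Product using (_,_; proj₁; proj₂; ∃)
open import Data.Empty using (⊥-elim)
open import Data.Sum using (_⊎_; inj₁; inj₂; swap)
open import Relation.Nullary using (Dec; yes; no)
open import Relation.Binary.PropositionalEquality
  using (_≡_; _≢_; refl; cong; cong₂; trans; subst; subst₂; module ≡-Reasoning)
import Relation.Binary.PropositionalEquality as ≡
open import Function using (_∘_; id)
open import Function.Definitions using (Injective)

-- Counting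

ind : Bool → ℕ
ind b = if b then 1 else 0

ind-mono : ∀ {b c : Bool} → (b ≡ true → c ≡ true) → ind b ≤ ind c
ind-mono {false} _   = z≤n
ind-mono {true}  b⇒c rewrite b⇒c refl = ≤-refl

count-cong : ∀ {n} {p q : Fin n → Bool} → (∀ i → p i ≡ q i) → count p ≡ count q
count-cong {zero}  p≗q = refl
count-cong {suc n} p≗q = cong₂ _+_ (cong ind (p≗q Fin.zero)) (count-cong (p≗q ∘ Fin.suc))

count-false : ∀ {n} → count {n} (λ _ → false) ≡ 0
count-false {zero}  = refl
count-false {suc n} = count-false {n}

count≡sumFin-ind : ∀ {n} (p : Fin n → Bool) → count p ≡ sumFin (ind ∘ p)
count≡sumFin-ind {zero}  p = refl
count≡sumFin-ind {suc n} p = cong (ind (p Fin.zero) +_) (count≡sumFin-ind (p ∘ Fin.suc))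

sumFin-cong : ∀ {n} {f g : Fin n → ℕ} → (∀ i → f i ≡ g i) → sumFin f ≡ sumFin g
sumFin-cong {zero}  f≗g = refl
sumFin-cong {suc n} f≗g = cong₂ _+_ (f≗g Fin.zero) (sumFin-cong (f≗g ∘ Fin.suc))

sumFin-+ : ∀ {n} (f g : Fin n → ℕ) → sumFin (λ i → f i + g i) ≡ sumFin f + sumFin g
sumFin-+ {zero}  f g = refl
sumFin-+ {suc n} f g =
  trans (cong (f Fin.zero + g Fin.zero +_) (sumFin-+ (f ∘ Fin.suc) (g ∘ Fin.suc)))
        (interchange (f Fin.zero) (g Fin.zero) _ _)
  where
  open +-*-Solver
  interchange : ∀ a b c d → a + b + (c + d) ≡ a + c + (b + d)
  interchange = solve 4 (λ a b c d → a :+ b :+ (c :+ d) := a :+ c :+ (b :+ d)) refl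

*≤sumFin : ∀ {n} (f : Fin n → ℕ) m → (∀ i → m ≤ f i) → m * n ≤ sumFin f
*≤sumFin {zero}  f m _    rewrite *-zeroʳ m = z≤n
*≤sumFin {suc n} f m m≤f  rewrite *-suc m n =
  +-mono-≤ (m≤f Fin.zero) (*≤sumFin (f ∘ Fin.suc) m (m≤f ∘ Fin.suc))

count-punchIn : ∀ {n} (q : Fin (suc n) → Bool) (i : Fin (suc n)) →
                count q ≡ ind (q i) + count (q ∘ punchIn i)
count-punchIn q Fin.zero = refl
count-punchIn {suc n} q (Fin.suc i) = begin
  ind (q Fin.zero) + count (q ∘ Fin.suc)
    ≡⟨ cong (ind (q Fin.zero) +_) (count-punchIn (q ∘ Fin.suc) i) ⟩
  ind (q Fin.zero) + (ind (q (Fin.suc i)) + rest)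
    ≡⟨ swap-front (ind (q Fin.zero)) (ind (q (Fin.suc i))) rest ⟩
  ind (q (Fin.suc i)) + (ind (q Fin.zero) + rest) ∎
  where
  open ≡-Reasoning
  rest = count (q ∘ Fin.suc ∘ punchIn i)
  open +-*-Solver
  swap-front : ∀ a b c → a + (b + c) ≡ b + (a + c)
  swap-front = solve 3 (λ a b c → a :+ (b :+ c) := b :+ (a :+ c)) refl

count-≤-injection : ∀ {h n} (f : Fin h → Fin n) → Injective _≡_ _≡_ f →
                    (p : Fin h → Bool) (q : Fin n → Bool) →
                    (∀ u → p u ≡ true → q (f u) ≡ true) → count p ≤ count q
count-≤-injection {zero}          f f-inj p q p⇒q = z≤n
count-≤-injection {suc h} {zero}  f f-inj p q p⇒q with f Fin.zero
... | ()
count-≤-injection {suc h} {suc n} f f-inj p q p⇒q rewrite count-punchIn q (f Fin.zero) =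
  +-mono-≤ (ind-mono (p⇒q Fin.zero))
           (count-≤-injection g g-inj (p ∘ Fin.suc) (q ∘ punchIn (f Fin.zero)) p⇒q∘g)
  where
  f0≢f : ∀ u → f Fin.zero ≢ f (Fin.suc u)
  f0≢f u eq with f-inj eq
  ... | ()
  g : Fin h → Fin n
  g u = punchOut (f0≢f u)
  g-inj : Injective _≡_ _≡_ g
  g-inj {x} {y} eq = Fin-suc-injective (f-inj (punchOut-injective (f0≢f x) (f0≢f y) eq))
  p⇒q∘g : ∀ u → p (Fin.suc u) ≡ true → q (punchIn (f Fin.zero) (g u)) ≡ true
  p⇒q∘g u pu = subst (λ z → q z ≡ true) (≡.sym (punchIn-punchOut (f0≢f u))) (p⇒q (Fin.suc u) pu)

count-mono : ∀ {n} (p q : Fin n → Bool) → (∀ u → p u ≡ true → q u ≡ true) → count p ≤ count q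
count-mono = count-≤-injection id id

takeTrue : ∀ {n} → (Fin n → Bool) → ℕ → Fin n → Bool
takeTrue p zero    i           = false
takeTrue p (suc t) Fin.zero    = p Fin.zero
takeTrue p (suc t) (Fin.suc i) = takeTrue (p ∘ Fin.suc) (if p Fin.zero then t else suc t) i

takeTrue⊆ : ∀ {n} (p : Fin n → Bool) t i → takeTrue p t i ≡ true → p i ≡ true
takeTrue⊆ p (suc t) Fin.zero    taken = taken
takeTrue⊆ p (suc t) (Fin.suc i) taken =
  takeTrue⊆ (p ∘ Fin.suc) (if p Fin.zero then t else suc t) i taken

count-takeTrue : ∀ {n} (p : Fin n → Bool) t → count (takeTrue p t) ≤ t
count-takeTrue {n}     p zero    = ≤-reflexive (count-false {n})
count-takeTrue {zero}  p (suc t) = z≤n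
count-takeTrue {suc n} p (suc t) with p Fin.zero | count-takeTrue (p ∘ Fin.suc) (if p Fin.zero then t else suc t)
... | true  | bound = s≤s bound
... | false | bound = bound

count-dropTrue : ∀ {n} (p : Fin n → Bool) t → count (λ i → p i ∧ not (takeTrue p t i)) ≤ count p ∸ t
count-dropTrue p zero = ≤-reflexive (count-cong (λ i → ∧-identityʳ (p i)))
count-dropTrue {zero}  p (suc t) = z≤n
count-dropTrue {suc n} p (suc t) with p Fin.zero | count-dropTrue (p ∘ Fin.suc) (if p Fin.zero then t else suc t)
... | true  | bound = bound
... | false | bound = bound

-- Graphs

induced : ∀ {n k} → Graph n → (Fin k → Fin n) → Graph k
induced G f = record
  { adj    = λ u v → adj G (f u) (f v)
  ; sym    = λ u v → sym G (f u) (f v)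
  ; irrefl = irrefl G ∘ f
  }

deleteVertex : ∀ {n} → Graph (suc n) → Fin (suc n) → Graph n
deleteVertex G w = induced G (punchIn w)

Subgraph-refl : ∀ {n} (G : Graph n) → Subgraph G G
Subgraph-refl G = id , id , λ _ _ → id

Subgraph-trans : ∀ {k m n} {J : Graph k} {G : Graph m} {H : Graph n} →
                 Subgraph J G → Subgraph G H → Subgraph J H
Subgraph-trans (f , f-inj , f-adj) (g , g-inj , g-adj) =
  g ∘ f , f-inj ∘ g-inj , λ u v → g-adj (f u) (f v) ∘ f-adj u v

deleteVertex-subgraph : ∀ {n} (G : Graph (suc n)) w → Subgraph (deleteVertex G w) G
deleteVertex-subgraph G w = punchIn w , punchIn-injective w _ _ , λ _ _ → id

MaxDensityBelowHalf-subgraph : ∀ {m n} {G : Graph m} {H : Graph n} {d} →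
  Subgraph G H → MaxDensityBelowHalf H d → MaxDensityBelowHalf G d
MaxDensityBelowHalf-subgraph {G = G} {H} G⊆H dens J J⊆G = dens J (Subgraph-trans {J = J} {G} {H} J⊆G G⊆H)

handshake : ∀ {n} (G : Graph n) → sumFin (degree G) ≡ 2 * ecount G
handshake {zero}  G = refl
handshake {suc n} G = begin
  sumFin (degree G)
    ≡⟨ cong (_+ sumFin (λ u → ind (adj G (Fin.suc u) Fin.zero) + degree G′ u)) degree0 ⟩
  c + sumFin (λ u → ind (adj G (Fin.suc u) Fin.zero) + degree G′ u)
    ≡⟨ cong (c +_) (sumFin-+ (λ u → ind (adj G (Fin.suc u) Fin.zero)) (degree G′)) ⟩
  c + (sumFin (λ u → ind (adj G (Fin.suc u) Fin.zero)) + sumFin (degree G′))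
    ≡⟨ cong₂ (λ x y → c + (x + y)) back-edges (handshake G′) ⟩
  c + (c + 2 * ecount G′)
    ≡⟨ regroup c (ecount G′) ⟩
  2 * (c + ecount G′)
    ≡⟨ cong (2 *_) (≡.sym ecount-step) ⟩
  2 * ecount G ∎
  where
  open ≡-Reasoning
  G′ = deleteVertex G Fin.zero
  c  = count (adj G Fin.zero ∘ Fin.suc)
  degree0 : degree G Fin.zero ≡ c
  degree0 rewrite irrefl G Fin.zero = refl
  back-edges : sumFin (λ u → ind (adj G (Fin.suc u) Fin.zero)) ≡ c
  back-edges = trans (≡.sym (count≡sumFin-ind (λ u → adj G (Fin.suc u) Fin.zero))) (count-cong (λ u → sym G (Fin.suc u) Fin.zero))
  open +-*-Solver
  regroup : ∀ a b → a + (a + 2 * b) ≡ 2 * (a + b)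
  regroup = solve 2 (λ a b → a :+ (a :+ con 2 :* b) := con 2 :* (a :+ b)) refl
  ecount-step : ecount G ≡ c + ecount G′
  ecount-step = cong₂ _+_ row0 (sumFin-cong row)
    where
    row0 : count (λ v → adj G Fin.zero v ∧ (0 <ᵇ toℕ v)) ≡ c
    row0 rewrite ∧-zeroʳ (adj G Fin.zero Fin.zero) = count-cong (λ v → ∧-identityʳ (adj G Fin.zero (Fin.suc v)))
    row : ∀ u → count (λ v → adj G (Fin.suc u) v ∧ (toℕ (Fin.suc u) <ᵇ toℕ v))
              ≡ count (λ v → adj G′ u v ∧ (toℕ u <ᵇ toℕ v))
    row u rewrite ∧-zeroʳ (adj G (Fin.suc u) Fin.zero) = refl

lowDegreeVertex : ∀ {n} (G : Graph (suc n)) {d} → MaxDensityBelowHalf G d →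
                  ∃ λ w → degree G w < 2 * d ∸ 1
lowDegreeVertex {n} G {d} dens with any? (λ w → degree G w <? 2 * d ∸ 1)
... | yes low = low
... | no ¬low = ⊥-elim (density-fails (dens G (Subgraph-refl G) (s≤s z≤n)))
  where
  density-fails : ¬ (2 * ecount G < (2 * d ∸ 1) * suc n)
  density-fails = ≤⇒≯ (begin
    (2 * d ∸ 1) * suc n ≤⟨ *≤sumFin (degree G) _ (λ w → ≮⇒≥ (¬low ∘ (w ,_))) ⟩
    sumFin (degree G)   ≡⟨ handshake G ⟩
    2 * ecount G        ∎)
    where open ≤-Reasoning

-- Orientations

outDegree : ∀ {n} {G : Graph n} → Orientation G → Fin n → ℕ
outDegree O v = count (arc O v)

inDegree : ∀ {n} {G : Graph n} → Orientation G → Fin n → ℕ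
inDegree O v = count (λ u → arc O u v)

antiDirected-degree : ∀ {h} {H : Graph h} (P : Orientation H) → AntiDirected P →
                      ∀ x → degree H x ≤ outDegree P x ⊎ degree H x ≤ inDegree P x
antiDirected-degree {H = H} P antiDirected x with antiDirected x
... | inj₁ noIn  = inj₁ (count-mono (adj H x) (arc P x) outward)
  where
  outward : ∀ u → adj H x u ≡ true → arc P x u ≡ true
  outward u xu with adj⇒arc P x u xu
  ... | inj₁ x→u = x→u
  ... | inj₂ u→x with trans (≡.sym u→x) (noIn u)
  ...   | ()
... | inj₂ noOut = inj₂ (count-mono (adj H x) (λ u → arc P u x) inward)
  where
  inward : ∀ u → adj H x u ≡ true → arc P u x ≡ true
  inward u xu with adj⇒arc P x u xu
  ... | inj₂ u→x = u→x
  ... | inj₁ x→u with trans (≡.sym x→u) (noOut u)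
  ...   | ()

module _ {n h} {G : Graph n} {H : Graph h} {O : Orientation G} {P : Orientation H} where

  copy-outDegree : (c : ContainsCopy O P) → ∀ x → outDegree P x ≤ outDegree O (proj₁ c x)
  copy-outDegree (f , f-inj , f-arc) x = count-≤-injection f f-inj (arc P x) (arc O (f x)) (f-arc x)

  copy-inDegree : (c : ContainsCopy O P) → ∀ x → inDegree P x ≤ inDegree O (proj₁ c x)
  copy-inDegree (f , f-inj , f-arc) x =
    count-≤-injection f f-inj (λ u → arc P u x) (λ v → arc O v (f x)) (λ u → f-arc u x)

  antiDirected-copy-degree : AntiDirected P → (c : ContainsCopy O P) → ∀ x →
    degree H x ≤ outDegree O (proj₁ c x) ⊎ degree H x ≤ inDegree O (proj₁ c x)
  antiDirected-copy-degree antiDirected c x with antiDirected-degree P antiDirected x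
  ... | inj₁ ≤out = inj₁ (≤-trans ≤out (copy-outDegree c x))
  ... | inj₂ ≤in  = inj₂ (≤-trans ≤in (copy-inDegree c x))

module ExtendAt {n} (G : Graph (suc n)) (w : Fin (suc n)) (O′ : Orientation (deleteVertex G w))
                (s : Fin (suc n) → Bool) (s⊆N : ∀ v → s v ≡ true → adj G w v ≡ true) where

  rest : Fin (suc n) → Bool
  rest v = adj G w v ∧ not (s v)

  arcCases : ∀ u v → Dec (w ≡ u) → Dec (w ≡ v) → Bool
  arcCases u v (yes _)   _         = s v
  arcCases u v (no _)    (yes _)   = rest u
  arcCases u v (no w≢u) (no w≢v) = arc O′ (punchOut w≢u) (punchOut w≢v)

  private
    noLoop : ∀ {A : Set} → adj G w w ≡ true → A
    noLoop ww with trans (≡.sym ww) (irrefl G w)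
    ... | ()

    rest-s : ∀ v → adj G w v ≡ true → s v ≡ true ⊎ rest v ≡ true
    rest-s v wv with s v
    ... | true  = inj₁ refl
    ... | false rewrite wv = inj₂ refl

    rest⊆N : ∀ v → rest v ≡ true → adj G w v ≡ true
    rest⊆N v with adj G w v
    ... | true  = λ _ → refl
    ... | false = λ ()

    s⇒¬rest : ∀ v → s v ≡ true → rest v ≡ false
    s⇒¬rest v sv rewrite sv = ∧-zeroʳ (adj G w v)

    rest⇒¬s : ∀ v → rest v ≡ true → s v ≡ false
    rest⇒¬s v with adj G w v | s v
    ... | true  | false = λ _ → refl
    ... | true  | true  = λ ()
    ... | false | _     = λ ()

    punchIn-punchOut-adj : ∀ {u v} (w≢u : w ≢ u) (w≢v : w ≢ v) →
                           adj G u v ≡ adj (deleteVertex G w) (punchOut w≢u) (punchOut w≢v)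
    punchIn-punchOut-adj w≢u w≢v =
      ≡.sym (cong₂ (adj G) (punchIn-punchOut w≢u) (punchIn-punchOut w≢v))

    cases⇒adj : ∀ u v du dv → arcCases u v du dv ≡ true → adj G u v ≡ true
    cases⇒adj u v (yes refl) dv       uv = s⊆N v uv
    cases⇒adj u v (no w≢u)   (yes refl) uv = trans (sym G u w) (rest⊆N u uv)
    cases⇒adj u v (no w≢u)   (no w≢v)   uv =
      trans (punchIn-punchOut-adj w≢u w≢v) (arc⇒adj O′ _ _ uv)

    adj⇒cases : ∀ u v du dv → adj G u v ≡ true → arcCases u v du dv ≡ true ⊎ arcCases v u dv du ≡ true
    adj⇒cases u v (yes refl) (yes refl) uv = noLoop uv
    adj⇒cases u v (yes refl) (no w≢v)   uv = rest-s v uv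
    adj⇒cases u v (no w≢u)   (yes refl) uv = swap (rest-s u (trans (sym G w u) uv))
    adj⇒cases u v (no w≢u)   (no w≢v)   uv =
      adj⇒arc O′ _ _ (trans (≡.sym (punchIn-punchOut-adj w≢u w≢v)) uv)

    cases-antisym : ∀ u v du dv → arcCases u v du dv ≡ true → arcCases v u dv du ≡ false
    cases-antisym u v (yes refl) (yes refl) uv = noLoop (s⊆N w uv)
    cases-antisym u v (yes refl) (no w≢v)   uv = s⇒¬rest v uv
    cases-antisym u v (no w≢u)   (yes refl) uv = rest⇒¬s u uv
    cases-antisym u v (no w≢u)   (no w≢v)   uv = antisym O′ _ _ uv

  O : Orientation G
  O = record
    { arc     = λ u v → arcCases u v (w ≟ u) (w ≟ v)
    ; arc⇒adj = λ u v → cases⇒adj u v (w ≟ u) (w ≟ v)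
    ; adj⇒arc = λ u v → adj⇒cases u v (w ≟ u) (w ≟ v)
    ; antisym = λ u v → cases-antisym u v (w ≟ u) (w ≟ v)
    }

  outDegree-centre : outDegree O w ≤ count s
  outDegree-centre = count-mono (arc O w) s out⊆s
    where
    out⊆s : ∀ v → arc O w v ≡ true → s v ≡ true
    out⊆s v with w ≟ w
    ... | yes _  = id
    ... | no w≢w = ⊥-elim (w≢w refl)

  inDegree-centre : inDegree O w ≤ count rest
  inDegree-centre = count-mono (λ u → arc O u w) rest in⊆rest
    where
    in⊆rest′ : ∀ u du dw → arcCases u w du dw ≡ true → rest u ≡ true
    in⊆rest′ u (yes refl) _          uw = noLoop (s⊆N w uw)
    in⊆rest′ u (no _)     (yes _)    uw = uw
    in⊆rest′ u (no _)     (no w≢w)   uw = ⊥-elim (w≢w refl)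
    in⊆rest : ∀ u → arc O u w ≡ true → rest u ≡ true
    in⊆rest u = in⊆rest′ u (w ≟ u) (w ≟ w)

  restrictCopy : ∀ {h} {H : Graph h} {P : Orientation H} (c : ContainsCopy O P) →
                 (∀ x → w ≢ proj₁ c x) → ContainsCopy O′ P
  restrictCopy (f , f-inj , f-arc) avoids =
    f′ , (λ {x} {y} eq → f-inj (punchOut-injective (avoids x) (avoids y) eq)) ,
    λ u v uv → restrict (f u) (f v) (w ≟ f u) (w ≟ f v) (avoids u) (avoids v) (f-arc u v uv)
    where
    f′ : _ → Fin n
    f′ x = punchOut (avoids x)
    restrict : ∀ a b da db (w≢a : w ≢ a) (w≢b : w ≢ b) → arcCases a b da db ≡ true →
               arc O′ (punchOut w≢a) (punchOut w≢b) ≡ true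
    restrict a b (yes w≡a) _         w≢a w≢b ab = ⊥-elim (w≢a w≡a)
    restrict a b (no _)    (yes w≡b) w≢a w≢b ab = ⊥-elim (w≢b w≡b)
    restrict a b (no _)    (no _)    w≢a w≢b ab =
      subst₂ (λ x y → arc O′ x y ≡ true) (punchOut-cong w refl) (punchOut-cong w refl) ab

module _ {h} {H : Graph h} {e : ℕ} (minDegree : IsMinDegree H (suc e))
         (P : Orientation H) (antiDirected : AntiDirected P) where

  orientAvoiding : ∀ {n} (G : Graph n) → MaxDensityBelowHalf G (suc e) →
                   Σ (Orientation G) λ O → ¬ ContainsCopy O P
  orientAvoiding {zero} G _ = noArcs , noCopy
    where
    noArcs : Orientation G
    noArcs = record { arc = λ _ _ → false ; arc⇒adj = λ () ; adj⇒arc = λ () ; antisym = λ () }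
    noCopy : ¬ ContainsCopy noArcs P
    noCopy (f , _) with f (proj₁ (proj₂ minDegree))
    ... | ()
  orientAvoiding {suc n} G dens with lowDegreeVertex G {suc e} dens
  ... | w , low = O , noCopy
    where
    rec : Σ (Orientation (deleteVertex G w)) λ O′ → ¬ ContainsCopy O′ P
    rec = orientAvoiding (deleteVertex G w)
            (MaxDensityBelowHalf-subgraph {G = deleteVertex G w} {G} {suc e}
              (deleteVertex-subgraph G w) dens)
    open ExtendAt G w (proj₁ rec) (takeTrue (adj G w) e) (takeTrue⊆ (adj G w) e)

    degree∸e≤e : degree G w ∸ e ≤ e
    degree∸e≤e = ≤-trans (s≤s⁻¹ (m<n+o⇒m∸n<o (degree G w) e low)) (≤-reflexive (+-identityʳ e))

    centre-degree≤e : ∀ {k} → k ≤ outDegree O w ⊎ k ≤ inDegree O w → k ≤ e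
    centre-degree≤e (inj₁ ≤out) =
      ≤-trans ≤out (≤-trans outDegree-centre (count-takeTrue (adj G w) e))
    centre-degree≤e (inj₂ ≤in) =
      ≤-trans ≤in (≤-trans inDegree-centre (≤-trans (count-dropTrue (adj G w) e) degree∸e≤e))

    noCopy : ¬ ContainsCopy O P
    noCopy c with any? (λ x → w ≟ proj₁ c x)
    ... | no avoids = proj₂ rec (restrictCopy {P = P} c (λ x w≡fx → avoids (x , w≡fx)))
    ... | yes (x , w≡fx) = ≤⇒≯ (centre-degree≤e throughCentre) (proj₁ minDegree x)
      where
      throughCentre : degree H x ≤ outDegree O w ⊎ degree H x ≤ inDegree O w
      throughCentre = subst (λ v → degree H x ≤ outDegree O v ⊎ degree H x ≤ inDegree O v)
                            (≡.sym w≡fx) (antiDirected-copy-degree {O = O} {P} antiDirected c x)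

theorem13 : ∀ {n h} (G : Graph n) (H : Graph h) (d : ℕ) →
    IsMinDegree H d → 2 ≤ d →
    (P : Orientation H) → AntiDirected P →
    MaxDensityBelowHalf G d →
    Σ (Orientation G) λ O → ¬ ContainsCopy O P
theorem13 G H (suc e) minDegree (s≤s _) P antiDirected dens =
  orientAvoiding minDegree P antiDirected G dens
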